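{- Let $\mathbf{v}=(v_1,\ldots,v_m)$ and $\mathbf{k}=(k_1,\ldots,k_m)$ be vectors of positive integers with $\mathbf{k}\leq\mathbf{v}$ (componentwise) and $k_i\geq 2$ for every $i$. Define $v_{\max}=\max_i v_i$ and $k_{\min}=\min_i k_i$. Then \[ C(\mathbf{v},\mathbf{k},2) \leq C(v_{\max},k_{\min},2). \]
   Context: Let $\mathbf{X}=(X_1,\ldots,X_m)$ be pairwise disjoint sets with $|X_i|=v_i$. A generalized covering design ${\rm GC}(\mathbf{v},\mathbf{k},t)$ is a family of blocks, each block being an $m$-tuple $(B_1,\ldots,B_m)$ with $B_i\subseteq X_i$ and $|B_i|=k_i$, such that every $m$-tuple $(T_1,\ldots,T_m)$ with $T_i\subseteq X_i$, $|T_i|=t_i$, $t_i\leq k_i$ and $\sum_i t_i=t$ is contained componentwise in at least one block. $C(\mathbf{v},\mathbf{k},t)$ denotes the minimum number of blocks of a ${\rm GC}(\mathbf{v},\mathbf{k},t)$. For integers $v\geq k\geq t$, $C(v,k,t)$ denotes the usual covering number: the minimum number of $k$-subsets of a $v$-set such that every $t$-subset is contained in at least one of them (this coincides with the case $m=1$). -}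

module Defs where

open import Data.Nat using (ℕ; zero; suc; _≤_; _⊔_; _⊓_)
open import Data.Nat.ListAction using (sum)
open import Data.Fin using (Fin; zero; suc)
open import Data.Fin.Subset using (Subset; _⊆_; ∣_∣)
open import Data.List using (List; length; tabulate)
open import Data.List.Relation.Unary.Any using (Any)
open import Data.List.Relation.Unary.All using (All)
open import Data.Product using (_×_)
open import Relation.Binary.PropositionalEquality using (_≡_)

-- The ground sets X_i are modelled as Fin (v i), i ∈ Fin m
-- (pairwise disjointness is automatic: they are separate components).
-- A tuple (T_1,…,T_m) with T_i ⊆ X_i.
Tuple : (m : ℕ) → (Fin m → ℕ) → Set
Tuple m v = (i : Fin m) → Subset (v i)

IsBlock : (m : ℕ) (v k : Fin m → ℕ) → Tuple m v → Set
IsBlock m v k B = (i : Fin m) → ∣ B i ∣ ≡ k i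

_⊆ᵗ_ : {m : ℕ} {v : Fin m → ℕ} → Tuple m v → Tuple m v → Set
T ⊆ᵗ B = ∀ i → T i ⊆ B i

-- The family F (a list of blocks; number of blocks = length F) is a GC(v,k,t).
IsGC : (m : ℕ) (v k : Fin m → ℕ) (t : ℕ) → List (Tuple m v) → Set
IsGC m v k t F =
  All (IsBlock m v k) F ×
  ((T : Tuple m v) → ((i : Fin m) → ∣ T i ∣ ≤ k i) →
     sum (tabulate (λ i → ∣ T i ∣)) ≡ t →
     Any (λ B → T ⊆ᵗ B) F)

IsCovering : (v k t : ℕ) → List (Subset v) → Set
IsCovering v k t F =
  All (λ B → ∣ B ∣ ≡ k) F ×
  ((T : Subset v) → ∣ T ∣ ≡ t → Any (λ B → T ⊆ B) F)

maxF : {m : ℕ} → (Fin (suc m) → ℕ) → ℕ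
maxF {zero} f = f zero
maxF {suc m} f = f zero ⊔ maxF (λ i → f (suc i))

minF : {m : ℕ} → (Fin (suc m) → ℕ) → ℕ
minF {zero} f = f zero
minF {suc m} f = f zero ⊓ minF (λ i → f (suc i))

{-# OPTIONS --safe #-}
-- Identify each X_i = Fin (v i) with the initial segment of length v i of a single vmax-set.
-- A block B of an ordinary covering design on that set then yields the generalized block
-- whose i-th component is B ∩ X_i, enlarged to size k i (possible as |B| = kmin ≤ k i ≤ v i).
-- A tuple (T_1,…,T_m) of total size t flattens to a subset of size at most t of the big set;
-- enlarging it to a t-subset, some block B covers it, and then each T_i ⊆ B ∩ X_i.
-- The construction keeps the number of blocks and works for every t ≤ vmax.
module Submission where

open import Defs
open import Data.Nat using (ℕ; zero; suc; _≤_; _<_; _+_; _∸_; z≤n; s≤s; s≤s⁻¹)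
open import Data.Nat.Properties
open import Data.Nat.ListAction using (sum)
open import Data.Fin using (Fin; zero; suc; inject≤)
open import Data.Fin.Subset using (Subset; _⊆_; ∣_∣; _∈_; _∪_; ⋃; inside; outside; ⊥)
open import Data.Fin.Subset.Properties using (∣⊥∣≡0; p⊆p∪q; q⊆p∪q)
open import Data.Vec using ([]; _∷_; here; there)
open import Data.List using (List; []; _∷_; length; map; tabulate)
open import Data.List.Properties using (length-map; map-tabulate; tabulate-cong)
open import Data.List.Relation.Unary.Any as Any using (Any; here; there)
open import Data.List.Relation.Unary.All as All using ()
import Data.List.Relation.Unary.Any.Properties as Anyₚ
import Data.List.Relation.Unary.All.Properties as Allₚ
open import Data.Product using (Σ; _×_; _,_)
open import Relation.Binary.PropositionalEquality using (_≡_; sym; trans; cong; subst)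

private
  variable
    n N : ℕ

pad : n ≤ N → Subset n → Subset N
pad z≤n     []      = ⊥
pad (s≤s p) (b ∷ S) = b ∷ pad p S

restrict : n ≤ N → Subset N → Subset n
restrict z≤n     _       = []
restrict (s≤s p) (b ∷ B) = b ∷ restrict p B

∈-pad : (p : n ≤ N) (S : Subset n) {x : Fin n} → x ∈ S → inject≤ x p ∈ pad p S
∈-pad (s≤s p) (b ∷ S) here      = here
∈-pad (s≤s p) (b ∷ S) (there x) = there (∈-pad p S x)

∈-restrict : (p : n ≤ N) (B : Subset N) {x : Fin n} → inject≤ x p ∈ B → x ∈ restrict p B
∈-restrict (s≤s p) (b ∷ B) {zero}  here      = here
∈-restrict (s≤s p) (b ∷ B) {suc x} (there y) = there (∈-restrict p B y)

∣pad∣≡ : (p : n ≤ N) (S : Subset n) → ∣ pad p S ∣ ≡ ∣ S ∣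
∣pad∣≡ {N = N} z≤n [] = ∣⊥∣≡0 N
∣pad∣≡ (s≤s p) (inside ∷ S)  = cong suc (∣pad∣≡ p S)
∣pad∣≡ (s≤s p) (outside ∷ S) = ∣pad∣≡ p S

∣restrict∣≤ : (p : n ≤ N) (B : Subset N) → ∣ restrict p B ∣ ≤ ∣ B ∣
∣restrict∣≤ z≤n     _             = z≤n
∣restrict∣≤ (s≤s p) (inside ∷ B)  = s≤s (∣restrict∣≤ p B)
∣restrict∣≤ (s≤s p) (outside ∷ B) = ∣restrict∣≤ p B

fill : ℕ → Subset n → Subset n
fill zero    S             = S
fill (suc b) []            = []
fill (suc b) (inside ∷ S)  = inside ∷ fill (suc b) S
fill (suc b) (outside ∷ S) = inside ∷ fill b S

⊆-fill : (b : ℕ) (S : Subset n) → S ⊆ fill b S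
⊆-fill zero    S             x∈S        = x∈S
⊆-fill (suc b) (inside ∷ S)  here       = here
⊆-fill (suc b) (inside ∷ S)  (there x∈S) = there (⊆-fill (suc b) S x∈S)
⊆-fill (suc b) (outside ∷ S) (there x∈S) = there (⊆-fill b S x∈S)

∣fill∣≡ : (b : ℕ) (S : Subset n) → ∣ S ∣ + b ≤ n → ∣ fill b S ∣ ≡ ∣ S ∣ + b
∣fill∣≡ zero    S             _   = sym (+-identityʳ ∣ S ∣)
∣fill∣≡ (suc b) []            ()
∣fill∣≡ (suc b) (inside ∷ S)  (s≤s h) = cong suc (∣fill∣≡ (suc b) S h)
∣fill∣≡ (suc b) (outside ∷ S) h =
  trans (cong suc (∣fill∣≡ b S (s≤s⁻¹ 1+S+b≤1+n))) (sym (+-suc ∣ S ∣ b))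
  where
  1+S+b≤1+n : suc (∣ S ∣ + b) ≤ suc _
  1+S+b≤1+n = ≤-trans (≤-reflexive (sym (+-suc ∣ S ∣ b))) h

grow : ℕ → Subset n → Subset n
grow k S = fill (k ∸ ∣ S ∣) S

⊆-grow : (k : ℕ) (S : Subset n) → S ⊆ grow k S
⊆-grow k S = ⊆-fill (k ∸ ∣ S ∣) S

∣grow∣≡ : {k : ℕ} (S : Subset n) → ∣ S ∣ ≤ k → k ≤ n → ∣ grow k S ∣ ≡ k
∣grow∣≡ {k = k} S S≤k k≤n = trans (∣fill∣≡ (k ∸ ∣ S ∣) S (≤-trans (≤-reflexive S+[k∸S]≡k) k≤n)) S+[k∸S]≡k
  where
  S+[k∸S]≡k : ∣ S ∣ + (k ∸ ∣ S ∣) ≡ k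
  S+[k∸S]≡k = m+[n∸m]≡n S≤k

∣p∪q∣≤∣p∣+∣q∣ : (p q : Subset n) → ∣ p ∪ q ∣ ≤ ∣ p ∣ + ∣ q ∣
∣p∪q∣≤∣p∣+∣q∣ []            []            = z≤n
∣p∪q∣≤∣p∣+∣q∣ (inside ∷ p)  (inside ∷ q)  = s≤s (≤-trans (∣p∪q∣≤∣p∣+∣q∣ p q) (+-monoʳ-≤ ∣ p ∣ (n≤1+n ∣ q ∣)))
∣p∪q∣≤∣p∣+∣q∣ (inside ∷ p)  (outside ∷ q) = s≤s (∣p∪q∣≤∣p∣+∣q∣ p q)
∣p∪q∣≤∣p∣+∣q∣ (outside ∷ p) (inside ∷ q)  = ≤-trans (s≤s (∣p∪q∣≤∣p∣+∣q∣ p q)) (≤-reflexive (sym (+-suc ∣ p ∣ ∣ q ∣)))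
∣p∪q∣≤∣p∣+∣q∣ (outside ∷ p) (outside ∷ q) = ∣p∪q∣≤∣p∣+∣q∣ p q

∣⋃∣≤sum : (ps : List (Subset n)) → ∣ ⋃ ps ∣ ≤ sum (map ∣_∣ ps)
∣⋃∣≤sum {n} []       = ≤-reflexive (∣⊥∣≡0 n)
∣⋃∣≤sum     (p ∷ ps) = ≤-trans (∣p∪q∣≤∣p∣+∣q∣ p (⋃ ps)) (+-monoʳ-≤ ∣ p ∣ (∣⋃∣≤sum ps))

∈⋃ : {x : Fin n} (ps : List (Subset n)) → Any (x ∈_) ps → x ∈ ⋃ ps
∈⋃ (p ∷ ps) (here x∈p)   = p⊆p∪q (⋃ ps) x∈p
∈⋃ (p ∷ ps) (there x∈ps) = q⊆p∪q p (⋃ ps) (∈⋃ ps x∈ps)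

module _ {m : ℕ} {v : Fin m → ℕ} {V : ℕ} (v≤V : ∀ i → v i ≤ V) where

  flatten : Tuple m v → Subset V
  flatten T = ⋃ (tabulate (λ i → pad (v≤V i) (T i)))

  ∣flatten∣≤ : (T : Tuple m v) → ∣ flatten T ∣ ≤ sum (tabulate (λ i → ∣ T i ∣))
  ∣flatten∣≤ T = begin
    ∣ flatten T ∣                                 ≤⟨ ∣⋃∣≤sum (tabulate padded) ⟩
    sum (map ∣_∣ (tabulate padded))               ≡⟨ cong sum (map-tabulate padded ∣_∣) ⟩
    sum (tabulate (λ i → ∣ padded i ∣))           ≡⟨ cong sum (tabulate-cong (λ i → ∣pad∣≡ (v≤V i) (T i))) ⟩
    sum (tabulate (λ i → ∣ T i ∣))                ∎
    where
    open ≤-Reasoning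
    padded : (i : Fin m) → Subset V
    padded i = pad (v≤V i) (T i)

  module _ {k : Fin m → ℕ} {K : ℕ} (K≤k : ∀ i → K ≤ k i) (k≤v : ∀ i → k i ≤ v i) where

    spread : Subset V → Tuple m v
    spread B i = grow (k i) (restrict (v≤V i) B)

    spread-isBlock : (B : Subset V) → ∣ B ∣ ≡ K → IsBlock m v k (spread B)
    spread-isBlock B ∣B∣≡K i =
      ∣grow∣≡ (restrict (v≤V i) B) (≤-trans (∣restrict∣≤ (v≤V i) B) (subst (_≤ k i) (sym ∣B∣≡K) (K≤k i))) (k≤v i)

    flatten⊆⇒⊆ᵗspread : (T : Tuple m v) (B : Subset V) → flatten T ⊆ B → T ⊆ᵗ spread B
    flatten⊆⇒⊆ᵗspread T B T⊆B i x∈Tᵢ =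
      ⊆-grow (k i) (restrict (v≤V i) B)
        (∈-restrict (v≤V i) B (T⊆B (∈⋃ _ (Anyₚ.tabulate⁺ i (∈-pad (v≤V i) (T i) x∈Tᵢ)))))

    isCovering⇒isGC : {t : ℕ} → t ≤ V → (F : List (Subset V)) → IsCovering V K t F → IsGC m v k t (map spread F)
    isCovering⇒isGC {t} t≤V F (blocks , covers) =
      Allₚ.map⁺ (All.map (λ {B} → spread-isBlock B) blocks) , coverTuple
      where
      coverTuple : (T : Tuple m v) → ((i : Fin m) → ∣ T i ∣ ≤ k i) →
                   sum (tabulate (λ i → ∣ T i ∣)) ≡ t → Any (λ B → T ⊆ᵗ B) (map spread F)
      coverTuple T _ ∑∣T∣≡t =
        Anyₚ.map⁺ (Any.map (λ W⊆B → flatten⊆⇒⊆ᵗspread T _ (λ x∈T → W⊆B (⊆-grow t _ x∈T))) (covers W ∣W∣≡t))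
        where
        W : Subset V
        W = grow t (flatten T)
        ∣W∣≡t : ∣ W ∣ ≡ t
        ∣W∣≡t = ∣grow∣≡ (flatten T) (subst (∣ flatten T ∣ ≤_) ∑∣T∣≡t (∣flatten∣≤ T)) t≤V

≤maxF : {m : ℕ} (f : Fin (suc m) → ℕ) (i : Fin (suc m)) → f i ≤ maxF f
≤maxF {zero}  f zero    = ≤-refl
≤maxF {suc m} f zero    = m≤m⊔n _ _
≤maxF {suc m} f (suc i) = ≤-trans (≤maxF (λ j → f (suc j)) i) (m≤n⊔m _ _)

minF≤ : {m : ℕ} (f : Fin (suc m) → ℕ) (i : Fin (suc m)) → minF f ≤ f i
minF≤ {zero}  f zero    = ≤-refl
minF≤ {suc m} f zero    = m⊓n≤m _ _
minF≤ {suc m} f (suc i) = ≤-trans (m⊓n≤n _ _) (minF≤ (λ j → f (suc j)) i)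

theorem3p18 : (m : ℕ) (v k : Fin (suc m) → ℕ) →
    ((i : Fin (suc m)) → 0 < v i) → ((i : Fin (suc m)) → 0 < k i) →
    ((i : Fin (suc m)) → k i ≤ v i) → ((i : Fin (suc m)) → 2 ≤ k i) →
    (F : List (Subset (maxF v))) → IsCovering (maxF v) (minF k) 2 F →
    Σ (List (Tuple (suc m) v)) (λ G → IsGC (suc m) v k 2 G × length G ≤ length F)
-- Positivity of v and k is implied by 2 ≤ k i ≤ v i.
theorem3p18 m v k _ _ k≤v 2≤k F isCov =
  map (spread v≤V K≤k k≤v) F ,
  isCovering⇒isGC v≤V K≤k k≤v 2≤V F isCov ,
  ≤-reflexive (length-map _ F)
  where
  v≤V : (i : Fin (suc m)) → v i ≤ maxF v
  v≤V = ≤maxF v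
  K≤k : (i : Fin (suc m)) → minF k ≤ k i
  K≤k = minF≤ k
  2≤V : 2 ≤ maxF v
  2≤V = ≤-trans (2≤k zero) (≤-trans (k≤v zero) (v≤V zero))
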